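{- Let $n \ge 1$ be an integer and let $B_1, B_2, \ldots$ be independent fair coin flips (each uniform on $\{0,1\}$). Consider the algorithm $\textsf{optimal\_uniform}(n)$: (1) set $m \leftarrow 1$, $X \leftarrow 1$; (2) while $m < n$: (3) draw the next fair coin flip $B$; (4) set $X \leftarrow X + Bm$ and $m \leftarrow 2m$; (5) if $m \ge n$ and $X \le n$ then set $m \leftarrow n$; (6) if $m \ge n$ and $X > n$ then set $X \leftarrow X - n$ and $m \leftarrow m - n$; (7) return $X$. Then the output of $\textsf{optimal\_uniform}(n)$ is uniformly distributed over $\{1, \ldots, n\}$. -}

module Defs where

open import Data.Bool using (Bool; true; false; if_then_else_)
open import Data.Nat using (ℕ; zero; suc; _+_; _*_; _∸_; _^_; _<ᵇ_; _≤ᵇ_; _≡ᵇ_)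
open import Data.Nat.Properties using (m^n≢0)
open import Data.List using (List; []; _∷_; map; _++_)
open import Data.Nat.ListAction using (sum)
open import Data.Maybe using (Maybe; just; nothing)
open import Data.Integer using (+_)
open import Data.Rational using (ℚ; _/_)

-- One run of the while loop of optimal_uniform(n), started in state (m , X),
-- reading fair coin flips from the given finite list.
-- Returns  just X  if the loop exits (m ≥ n) using only the supplied flips,
-- and  nothing  if it needs more flips than supplied.
loop : (n m X : ℕ) → List Bool → Maybe ℕ
loop n m X bs with m <ᵇ n
... | false = just X
loop n m X [] | true = nothing
loop n m X (b ∷ bs) | true =
  let X′ = X + (if b then m else 0)
      m′ = 2 * m
  in if n ≤ᵇ m′
     then (if X′ ≤ᵇ n
           then loop n n X′ bs
           else loop n (m′ ∸ n) (X′ ∸ n) bs)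
     else loop n m′ X′ bs

optimalUniform : ℕ → List Bool → Maybe ℕ
optimalUniform n bs = loop n 1 1 bs

allBits : ℕ → List (List Bool)
allBits zero = [] ∷ []
allBits (suc t) = map (true ∷_) (allBits t) ++ map (false ∷_) (allBits t)

hit : ℕ → Maybe ℕ → ℕ
hit k (just x) = if x ≡ᵇ k then 1 else 0
hit k nothing = 0

countOut : ℕ → ℕ → ℕ → ℕ
countOut n k t = sum (map (λ bs → hit k (optimalUniform n bs)) (allBits t))

-- Pr[ the algorithm halts within the first t flips and outputs k ].
probWithin : ℕ → ℕ → ℕ → ℚ
probWithin n k t = _/_ (+ countOut n k t) (2 ^ t) {{m^n≢0 2 t}}

{-# OPTIONS --safe #-}
-- Let hits m t k count the pairs (X, B), 1 ≤ X ≤ m and B ∈ {0,1}ᵗ, on which the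
-- loop started in state (m, X) halts within t flips with output k.  A flip turns
-- X uniform on [1, m] into X + Bm uniform on [1, 2m]; if 2m ≥ n the values ≤ n halt,
-- one for each output, and the others restart from state 2m − n with X − n uniform
-- on [1, 2m − n].  Hence, by induction on t, hits m t k = ⌊m 2ᵗ / n⌋ for every
-- k ∈ [1, n], so the probability of output k within t flips is ⌊2ᵗ/n⌋/2ᵗ, which
-- differs from 1/n by less than 1/2ᵗ.
module Submission where

open import Defs

module Counting where
  open import Data.Bool using (Bool; true; false; if_then_else_)
  open import Data.List using (List; []; _∷_; map; _++_)
  open import Data.List.Properties using (map-++; map-∘; map-cong)
  open import Data.Maybe using (Maybe; just; nothing)
  open import Data.Nat
  open import Data.Nat.DivMod using (m*n/n≡m; m<n⇒m/n≡0; +-distrib-/-∣ˡ)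
  open import Data.Nat.Divisibility using (m∣m*n)
  open import Data.Nat.ListAction using (sum)
  open import Data.Nat.ListAction.Properties using (sum-++)
  open import Data.Nat.Properties
  open import Algebra.Properties.CommutativeSemigroup +-commutativeSemigroup using (interchange)
  open import Data.Sum using (inj₁; inj₂)
  open import Function using (_∘_; const)
  open import Relation.Binary.PropositionalEquality
  open import Relation.Nullary using (yes; no)
  open import Relation.Nullary.Decidable using (dec-true; dec-false)
  open ≡-Reasoning

  sumBits : (List Bool → ℕ) → ℕ → ℕ
  sumBits f t = sum (map f (allBits t))

  sumBits-suc : ∀ f t → sumBits f (suc t) ≡ sumBits (f ∘ (true ∷_)) t + sumBits (f ∘ (false ∷_)) t
  sumBits-suc f t = begin
    sum (map f (map (true ∷_) bss ++ map (false ∷_) bss))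
      ≡⟨ cong sum (map-++ f (map (true ∷_) bss) _) ⟩
    sum (map f (map (true ∷_) bss) ++ map f (map (false ∷_) bss))
      ≡⟨ sum-++ (map f (map (true ∷_) bss)) _ ⟩
    sum (map f (map (true ∷_) bss)) + sum (map f (map (false ∷_) bss))
      ≡⟨ cong₂ _+_ (cong sum (sym (map-∘ bss))) (cong sum (sym (map-∘ bss))) ⟩
    sumBits (f ∘ (true ∷_)) t + sumBits (f ∘ (false ∷_)) t ∎
    where
    bss : List (List Bool)
    bss = allBits t

  sumBits-cong : ∀ {f g} → (∀ bs → f bs ≡ g bs) → ∀ t → sumBits f t ≡ sumBits g t
  sumBits-cong f≗g t = cong sum (map-cong f≗g (allBits t))

  sumBits-const : ∀ c t → sumBits (const c) t ≡ 2 ^ t * c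
  sumBits-const c zero = refl
  sumBits-const c (suc t) = begin
    sumBits (const c) (suc t)                  ≡⟨ sumBits-suc (const c) t ⟩
    sumBits (const c) t + sumBits (const c) t  ≡⟨ cong₂ _+_ (sumBits-const c t) (sumBits-const c t) ⟩
    2 ^ t * c + 2 ^ t * c                      ≡⟨ cong (2 ^ t * c +_) (sym (+-identityʳ (2 ^ t * c))) ⟩
    2 * (2 ^ t * c)                            ≡⟨ *-assoc 2 (2 ^ t) c ⟨
    2 ^ suc t * c                              ∎

  sumTo : (ℕ → ℕ) → ℕ → ℕ
  sumTo f zero = 0
  sumTo f (suc m) = sumTo f m + f (suc m)

  sumTo-cong : ∀ {f g} m → (∀ x → 1 ≤ x → x ≤ m → f x ≡ g x) → sumTo f m ≡ sumTo g m
  sumTo-cong zero f≗g = refl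
  sumTo-cong (suc m) f≗g =
    cong₂ _+_ (sumTo-cong m (λ x 1≤x x≤m → f≗g x 1≤x (m≤n⇒m≤1+n x≤m))) (f≗g (suc m) (s≤s z≤n) ≤-refl)

  sumTo-+ : ∀ f g m → sumTo (λ x → f x + g x) m ≡ sumTo f m + sumTo g m
  sumTo-+ f g zero = refl
  sumTo-+ f g (suc m) =
    trans (cong (_+ (f (suc m) + g (suc m))) (sumTo-+ f g m))
          (interchange (sumTo f m) (sumTo g m) (f (suc m)) (g (suc m)))

  sumTo-*ˡ : ∀ c f m → sumTo (λ x → c * f x) m ≡ c * sumTo f m
  sumTo-*ˡ c f zero = sym (*-zeroʳ c)
  sumTo-*ˡ c f (suc m) =
    trans (cong (_+ c * f (suc m)) (sumTo-*ˡ c f m)) (sym (*-distribˡ-+ c (sumTo f m) _))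

  sumTo-split : ∀ f a b → sumTo f (b + a) ≡ sumTo f a + sumTo (λ y → f (y + a)) b
  sumTo-split f a zero = sym (+-identityʳ (sumTo f a))
  sumTo-split f a (suc b) =
    trans (cong (_+ f (suc b + a)) (sumTo-split f a b)) (+-assoc (sumTo f a) _ _)

  hit-just-≢ : ∀ {k x} → x ≢ k → hit k (just x) ≡ 0
  hit-just-≢ {k} {x} x≢k = cong (if_then 1 else 0) (dec-false (x ≟ k) x≢k)

  hit-just-refl : ∀ k → hit k (just k) ≡ 1
  hit-just-refl k = cong (if_then 1 else 0) (dec-true (k ≟ k) refl)

  sumTo-hit-< : ∀ {k} m → m < k → sumTo (hit k ∘ just) m ≡ 0
  sumTo-hit-< zero m<k = refl
  sumTo-hit-< (suc m) m<k =
    cong₂ _+_ (sumTo-hit-< m (<-trans (n<1+n m) m<k)) (hit-just-≢ (<⇒≢ m<k))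

  sumTo-hit : ∀ {k} m → 1 ≤ k → k ≤ m → sumTo (hit k ∘ just) m ≡ 1
  sumTo-hit zero (s≤s _) ()
  sumTo-hit (suc m) 1≤k k≤1+m with m≤n⇒m<n∨m≡n k≤1+m
  ... | inj₁ k<1+m = cong₂ _+_ (sumTo-hit m 1≤k (s≤s⁻¹ k<1+m)) (hit-just-≢ (>⇒≢ k<1+m))
  ... | inj₂ refl  = cong₂ _+_ (sumTo-hit-< m ≤-refl) (hit-just-refl (suc m))

  [n*a+b]/n≡a+b/n : ∀ n .{{_ : NonZero n}} a b → (n * a + b) / n ≡ a + b / n
  [n*a+b]/n≡a+b/n n a b = trans (+-distrib-/-∣ˡ b (m∣m*n a)) (cong (_+ b / n) n*a/n≡a)
    where
    n*a/n≡a : n * a / n ≡ a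
    n*a/n≡a = trans (cong (_/ n) (*-comm n a)) (m*n/n≡m a n)

  2*m*2^t≡m*2^[1+t] : ∀ m t → 2 * m * 2 ^ t ≡ m * 2 ^ suc t
  2*m*2^t≡m*2^[1+t] m t = trans (cong (_* 2 ^ t) (*-comm 2 m)) (*-assoc m 2 (2 ^ t))

  module _ (n : ℕ) .{{_ : NonZero n}} where

    -- steps (5) and (6), applied to the value Y of X after step (4)
    afterFlip : ℕ → ℕ → List Bool → Maybe ℕ
    afterFlip m Y bs =
      if n ≤ᵇ 2 * m
      then (if Y ≤ᵇ n then loop n n Y bs else loop n (2 * m ∸ n) (Y ∸ n) bs)
      else loop n (2 * m) Y bs

    loop-done : ∀ X bs → loop n n X bs ≡ just X
    loop-done X bs rewrite dec-false (n <? n) (n≮n n) = refl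

    loop-[] : ∀ {m} X → m < n → loop n m X [] ≡ nothing
    loop-[] {m} X m<n rewrite dec-true (m <? n) m<n = refl

    loop-∷ : ∀ {m} X b bs → m < n → loop n m X (b ∷ bs) ≡ afterFlip m (X + (if b then m else 0)) bs
    loop-∷ {m} X b bs m<n rewrite dec-true (m <? n) m<n = refl

    afterFlip-< : ∀ m Y bs → 2 * m < n → afterFlip m Y bs ≡ loop n (2 * m) Y bs
    afterFlip-< m Y bs 2m<n rewrite dec-false (n ≤? 2 * m) (<⇒≱ 2m<n) = refl

    afterFlip-≤ : ∀ m Y bs → n ≤ 2 * m → Y ≤ n → afterFlip m Y bs ≡ loop n n Y bs
    afterFlip-≤ m Y bs n≤2m Y≤n rewrite dec-true (n ≤? 2 * m) n≤2m | dec-true (Y ≤? n) Y≤n = refl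

    afterFlip-> : ∀ m j bs → n ≤ 2 * m → 1 ≤ j → afterFlip m (j + n) bs ≡ loop n (2 * m ∸ n) j bs
    afterFlip-> m j bs n≤2m 1≤j
      rewrite dec-true (n ≤? 2 * m) n≤2m | dec-false (j + n ≤? n) (<⇒≱ (m<n+m n 1≤j)) | m+n∸n≡m j n = refl

    hits : ℕ → ℕ → ℕ → ℕ
    hits m t k = sumTo (λ X → sumBits (hit k ∘ loop n m X) t) m

    hits-done : ∀ {k} → 1 ≤ k → k ≤ n → ∀ t → hits n t k ≡ 2 ^ t
    hits-done {k} 1≤k k≤n t = begin
      hits n t k                             ≡⟨ sumTo-cong n (λ X _ _ → done X) ⟩
      sumTo (λ X → 2 ^ t * hit k (just X)) n ≡⟨ sumTo-*ˡ (2 ^ t) (hit k ∘ just) n ⟩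
      2 ^ t * sumTo (hit k ∘ just) n         ≡⟨ cong (2 ^ t *_) (sumTo-hit n 1≤k k≤n) ⟩
      2 ^ t * 1                              ≡⟨ *-identityʳ (2 ^ t) ⟩
      2 ^ t                                  ∎
      where
      done : ∀ X → sumBits (hit k ∘ loop n n X) t ≡ 2 ^ t * hit k (just X)
      done X = trans (sumBits-cong (λ bs → cong (hit k) (loop-done X bs)) t) (sumBits-const _ t)

    hits-zero : ∀ {m} k → m < n → hits m 0 k ≡ 0
    hits-zero {m} k m<n = trans (sumTo-cong m (λ X _ _ → cong (λ r → hit k r + 0) (loop-[] X m<n)))
                                (sumTo-*ˡ 0 (const 0) m)

    hits-suc : ∀ {m} t k → m < n →
               hits m (suc t) k ≡ sumTo (λ Y → sumBits (hit k ∘ afterFlip m Y) t) (2 * m)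
    hits-suc {m} t k m<n = begin
      hits m (suc t) k                            ≡⟨ sumTo-cong m (λ X _ _ → firstFlip X) ⟩
      sumTo (λ X → G X + G (X + m)) m             ≡⟨ sumTo-+ G (λ X → G (X + m)) m ⟩
      sumTo G m + sumTo (λ X → G (X + m)) m       ≡⟨ sumTo-split G m m ⟨
      sumTo G (m + m)                             ≡⟨ cong (λ x → sumTo G (m + x)) (+-identityʳ m) ⟨
      sumTo G (2 * m)                             ∎
      where
      G : ℕ → ℕ
      G Y = sumBits (hit k ∘ afterFlip m Y) t
      onFlip : ∀ X b → sumBits (hit k ∘ loop n m X ∘ (b ∷_)) t ≡ G (X + (if b then m else 0))
      onFlip X b = sumBits-cong (λ bs → cong (hit k) (loop-∷ X b bs m<n)) t
      firstFlip : ∀ X → sumBits (hit k ∘ loop n m X) (suc t) ≡ G X + G (X + m)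
      firstFlip X = begin
        sumBits (hit k ∘ loop n m X) (suc t) ≡⟨ sumBits-suc (hit k ∘ loop n m X) t ⟩
        sumBits (hit k ∘ loop n m X ∘ (true ∷_)) t + sumBits (hit k ∘ loop n m X ∘ (false ∷_)) t
                                             ≡⟨ cong₂ _+_ (onFlip X true) (onFlip X false) ⟩
        G (X + m) + G (X + 0)                ≡⟨ cong (λ Y → G (X + m) + G Y) (+-identityʳ X) ⟩
        G (X + m) + G X                      ≡⟨ +-comm (G (X + m)) (G X) ⟩
        G X + G (X + m)                      ∎

    hits-suc-< : ∀ m t k → 2 * m < n → hits m (suc t) k ≡ hits (2 * m) t k
    hits-suc-< m t k 2m<n =
      trans (hits-suc t k (≤-<-trans (m≤n*m m 2) 2m<n))
            (sumTo-cong (2 * m) (λ Y _ _ → sumBits-cong (λ bs → cong (hit k) (afterFlip-< m Y bs 2m<n)) t))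

    hits-suc-≥ : ∀ {m} t k → 1 ≤ k → k ≤ n → m < n → n ≤ 2 * m →
                 hits m (suc t) k ≡ 2 ^ t + hits (2 * m ∸ n) t k
    hits-suc-≥ {m} t k 1≤k k≤n m<n n≤2m = begin
      hits m (suc t) k                       ≡⟨ hits-suc t k m<n ⟩
      sumTo G (2 * m)                        ≡⟨ cong (sumTo G) (m∸n+n≡m n≤2m) ⟨
      sumTo G (r + n)                        ≡⟨ sumTo-split G n r ⟩
      sumTo G n + sumTo (λ j → G (j + n)) r  ≡⟨ cong₂ _+_ (sumTo-cong n halt) (sumTo-cong r restart) ⟩
      hits n t k + hits r t k                ≡⟨ cong (_+ hits r t k) (hits-done 1≤k k≤n t) ⟩
      2 ^ t + hits r t k                     ∎
      where
      r : ℕ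
      r = 2 * m ∸ n
      G : ℕ → ℕ
      G Y = sumBits (hit k ∘ afterFlip m Y) t
      halt : ∀ Y → 1 ≤ Y → Y ≤ n → G Y ≡ sumBits (hit k ∘ loop n n Y) t
      halt Y _ Y≤n = sumBits-cong (λ bs → cong (hit k) (afterFlip-≤ m Y bs n≤2m Y≤n)) t
      restart : ∀ j → 1 ≤ j → j ≤ r → G (j + n) ≡ sumBits (hit k ∘ loop n r j) t
      restart j 1≤j _ = sumBits-cong (λ bs → cong (hit k) (afterFlip-> m j bs n≤2m 1≤j)) t

    hits≡m*2^t/n : ∀ {k} → 1 ≤ k → k ≤ n → ∀ t m → m ≤ n → hits m t k ≡ m * 2 ^ t / n
    hits≡m*2^t/n {k} 1≤k k≤n t m m≤n with m≤n⇒m<n∨m≡n m≤n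
    ... | inj₂ refl = begin
      hits n t k       ≡⟨ hits-done 1≤k k≤n t ⟩
      2 ^ t            ≡⟨ m*n/n≡m (2 ^ t) n ⟨
      2 ^ t * n / n    ≡⟨ cong (_/ n) (*-comm (2 ^ t) n) ⟩
      n * 2 ^ t / n    ∎
    hits≡m*2^t/n {k} 1≤k k≤n zero m _ | inj₁ m<n = begin
      hits m 0 k       ≡⟨ hits-zero k m<n ⟩
      0                ≡⟨ m<n⇒m/n≡0 m<n ⟨
      m / n            ≡⟨ cong (_/ n) (*-identityʳ m) ⟨
      m * 1 / n        ∎
    hits≡m*2^t/n {k} 1≤k k≤n (suc t) m _ | inj₁ m<n with 2 * m <? n
    ... | yes 2m<n = begin
      hits m (suc t) k     ≡⟨ hits-suc-< m t k 2m<n ⟩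
      hits (2 * m) t k     ≡⟨ hits≡m*2^t/n 1≤k k≤n t (2 * m) (<⇒≤ 2m<n) ⟩
      2 * m * 2 ^ t / n    ≡⟨ cong (_/ n) (2*m*2^t≡m*2^[1+t] m t) ⟩
      m * 2 ^ suc t / n    ∎
    ... | no 2m≮n = begin
      hits m (suc t) k               ≡⟨ hits-suc-≥ t k 1≤k k≤n m<n n≤2m ⟩
      2 ^ t + hits r t k             ≡⟨ cong (2 ^ t +_) (hits≡m*2^t/n 1≤k k≤n t r r≤n) ⟩
      2 ^ t + r * 2 ^ t / n          ≡⟨ [n*a+b]/n≡a+b/n n (2 ^ t) (r * 2 ^ t) ⟨
      (n * 2 ^ t + r * 2 ^ t) / n    ≡⟨ cong (_/ n) (*-distribʳ-+ (2 ^ t) n r) ⟨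
      (n + r) * 2 ^ t / n            ≡⟨ cong (λ x → x * 2 ^ t / n) (m+[n∸m]≡n n≤2m) ⟩
      2 * m * 2 ^ t / n              ≡⟨ cong (_/ n) (2*m*2^t≡m*2^[1+t] m t) ⟩
      m * 2 ^ suc t / n              ∎
      where
      n≤2m : n ≤ 2 * m
      n≤2m = ≮⇒≥ 2m≮n
      r : ℕ
      r = 2 * m ∸ n
      r≤n : r ≤ n
      r≤n = m≤n+o⇒m∸n≤o (2 * m) n
              (≤-trans (*-monoʳ-≤ 2 (<⇒≤ m<n)) (≤-reflexive (cong (n +_) (+-identityʳ n))))

  countOut≡2^t/n : ∀ n .{{_ : NonZero n}} k → 1 ≤ k → k ≤ n → ∀ t → countOut n k t ≡ 2 ^ t / n
  countOut≡2^t/n n k 1≤k k≤n t =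
    trans (hits≡m*2^t/n n 1≤k k≤n t 1 (>-nonZero⁻¹ n)) (cong (_/ n) (*-identityˡ (2 ^ t)))

module Approximation where
  open import Data.Integer as ℤ using (+_; +[1+_]; -[1+_]; _⊖_)
  import Data.Integer.Properties as ℤ
  open import Data.Nat as ℕ using (ℕ; zero; suc; NonZero; _+_; _^_)
  import Data.Nat.DivMod as ℕ
  import Data.Nat.Properties as ℕ
  open import Data.Rational using (ℚ; mkℚ; _/_; _-_; ∣_∣; _<_; _≤_; 0ℚ; *<*; toℚᵘ; ↧ₙ_)
  open import Data.Rational.Properties
    using (toℚᵘ-cancel-<; toℚᵘ-cancel-≤; toℚᵘ-homo-∣-∣; toℚᵘ-homo-+; toℚᵘ-homo‿-; toℚᵘ-fromℚᵘ)
  open import Data.Rational.Unnormalised as ℚᵘ using (mkℚᵘ)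
  import Data.Rational.Unnormalised.Properties as ℚᵘ
  open import Relation.Binary.PropositionalEquality

  n<2^n : ∀ n → n ℕ.< 2 ^ n
  n<2^n zero = ℕ.z<s
  n<2^n (suc n) = begin-strict
    suc n          ≡⟨ ℕ.+-comm 1 n ⟩
    n + 1          <⟨ ℕ.+-mono-<-≤ (n<2^n n) (ℕ.m^n>0 2 n) ⟩
    2 ^ n + 2 ^ n  ≡⟨ cong (λ x → 2 ^ n + x) (ℕ.+-identityʳ (2 ^ n)) ⟨
    2 ^ suc n      ∎
    where open ℕ.≤-Reasoning

  ∣⌊m/n⌋/m-1/n∣<1/m : ∀ m n .{{_ : NonZero m}} .{{_ : NonZero n}} →
                      ∣ + (m ℕ./ n) / m - + 1 / n ∣ < + 1 / m
  ∣⌊m/n⌋/m-1/n∣<1/m m@(suc m-1) n@(suc n-1) = toℚᵘ-cancel-< bound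
    where
    q : ℚ
    q = + (m ℕ./ n) / m

    numerator : ℤ.∣ + (m ℕ./ n) ℤ.* + n ℤ.+ -[1+ 0 ] ℤ.* + m ∣ ≡ m ℕ.% n
    numerator = begin
      ℤ.∣ + (m ℕ./ n) ℤ.* + n ℤ.+ -[1+ 0 ] ℤ.* + m ∣
        ≡⟨ cong₂ (λ a b → ℤ.∣ a ℤ.+ b ∣) (ℤ.pos-* (m ℕ./ n) n) (sym (ℤ.-1*i≡-i (+ m))) ⟨
      ℤ.∣ + (m ℕ./ n ℕ.* n) ℤ.- + m ∣
        ≡⟨ cong ℤ.∣_∣ (ℤ.m-n≡m⊖n (m ℕ./ n ℕ.* n) m) ⟩
      ℤ.∣ m ℕ./ n ℕ.* n ⊖ m ∣
        ≡⟨ ℤ.∣⊖∣-≤ (ℕ.m/n*n≤m m n) ⟩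
      m ℕ.∸ m ℕ./ n ℕ.* n
        ≡⟨ ℕ.m%n≡m∸m/n*n m n ⟨
      m ℕ.% n ∎
      where open ≡-Reasoning

    m%n*m<m*n : m ℕ.% n ℕ.* m ℕ.< m ℕ.* n
    m%n*m<m*n = ℕ.<-≤-trans (ℕ.*-monoˡ-< m (ℕ.m%n<n m n)) (ℕ.≤-reflexive (ℕ.*-comm n m))

    bound : toℚᵘ ∣ q - + 1 / n ∣ ℚᵘ.< toℚᵘ (+ 1 / m)
    bound = begin-strict
        toℚᵘ ∣ q - + 1 / n ∣
      ≃⟨ toℚᵘ-homo-∣-∣ (q - + 1 / n) ⟩
        ℚᵘ.∣ toℚᵘ (q - + 1 / n) ∣
      ≃⟨ ℚᵘ.∣-∣-cong (ℚᵘ.≃-trans (toℚᵘ-homo-+ q _) (ℚᵘ.+-cong (toℚᵘ-fromℚᵘ (mkℚᵘ (+ (m ℕ./ n)) m-1))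
           (ℚᵘ.≃-trans (toℚᵘ-homo‿- (+ 1 / n)) (ℚᵘ.-‿cong (toℚᵘ-fromℚᵘ (mkℚᵘ (+ 1) n-1)))))) ⟩
        ℚᵘ.∣ mkℚᵘ (+ (m ℕ./ n)) m-1 ℚᵘ.- mkℚᵘ (+ 1) n-1 ∣
      ≡⟨ cong (λ r → mkℚᵘ (+ r) (ℕ.pred (m ℕ.* n))) numerator ⟩
        mkℚᵘ (+ (m ℕ.% n)) (ℕ.pred (m ℕ.* n))
      <⟨ ℚᵘ.*<* (subst₂ ℤ._<_ (ℤ.pos-* (m ℕ.% n) m) (sym (ℤ.*-identityˡ (+ (m ℕ.* n)))) (ℤ.+<+ m%n*m<m*n)) ⟩
        mkℚᵘ (+ 1) m-1
      ≃⟨ toℚᵘ-fromℚᵘ (mkℚᵘ (+ 1) m-1) ⟨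
        toℚᵘ (+ 1 / m)
      ∎
      where open ℚᵘ.≤-Reasoning

  1/m≤p : ∀ {p} → 0ℚ < p → ∀ m .{{_ : NonZero m}} → ↧ₙ p ℕ.≤ m → + 1 / m ≤ p
  1/m≤p {mkℚ +[1+ a ] b-1 _} _ m@(suc m-1) ↧p≤m = toℚᵘ-cancel-≤ (begin
      toℚᵘ (+ 1 / m)     ≃⟨ toℚᵘ-fromℚᵘ (mkℚᵘ (+ 1) m-1) ⟩
      mkℚᵘ (+ 1) m-1     ≤⟨ ℚᵘ.*≤* (subst₂ ℤ._≤_ (sym (ℤ.*-identityˡ (+ suc b-1))) (ℤ.pos-* (suc a) m)
                              (ℤ.+≤+ (ℕ.≤-trans ↧p≤m (ℕ.m≤n*m m (suc a))))) ⟩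
      mkℚᵘ +[1+ a ] b-1  ∎)
    where open ℚᵘ.≤-Reasoning
  1/m≤p {mkℚ (+ zero) _ _} (*<* (ℤ.+<+ ())) _ _
  1/m≤p {mkℚ -[1+ _ ] _ _} (*<* ()) _ _

open import Data.Nat using (ℕ; NonZero; _≤_)
open import Data.Product using (∃)
open import Data.Integer using (+_)
open import Data.Rational using (ℚ; _/_; _-_; ∣_∣; _<_; 0ℚ)

import Data.Nat as ℕ
open import Data.Nat.Properties using (<-≤-trans; <⇒≤; ^-monoʳ-≤; m^n≢0)
open import Data.Product using (_,_)
open import Data.Rational using (↧ₙ_)
open import Data.Rational.Properties using (module ≤-Reasoning)
open import Relation.Binary.PropositionalEquality using (cong)
open Counting using (countOut≡2^t/n)
open Approximation using (n<2^n; ∣⌊m/n⌋/m-1/n∣<1/m; 1/m≤p)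

theorem1 : (n : ℕ) .{{_ : NonZero n}} → (k : ℕ) → 1 ≤ k → k ≤ n →
             (ε : ℚ) → 0ℚ < ε →
             ∃ λ (T : ℕ) → (t : ℕ) → T ≤ t →
               ∣ probWithin n k t - (+ 1) / n ∣ < ε
theorem1 n k 1≤k k≤n ε 0<ε = ↧ₙ ε , close
  where
  close : ∀ t → ↧ₙ ε ≤ t → ∣ probWithin n k t - + 1 / n ∣ < ε
  close t ↧ε≤t = begin-strict
    ∣ probWithin n k t - + 1 / n ∣        ≡⟨ cong (λ c → ∣ + c / 2^t - + 1 / n ∣) (countOut≡2^t/n n k 1≤k k≤n t) ⟩
    ∣ + (2^t ℕ./ n) / 2^t - + 1 / n ∣     <⟨ ∣⌊m/n⌋/m-1/n∣<1/m 2^t n ⟩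
    + 1 / 2^t                            ≤⟨ 1/m≤p 0<ε 2^t (<⇒≤ (<-≤-trans (n<2^n (↧ₙ ε)) (^-monoʳ-≤ 2 ↧ε≤t))) ⟩
    ε                                    ∎
    where
    open ≤-Reasoning
    2^t : ℕ
    2^t = 2 ℕ.^ t
    instance
      2^t≢0 : NonZero 2^t
      2^t≢0 = m^n≢0 2 t
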